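{- $t(3)=4$.
   Context: Finite rooted trees are structures over a binary relation $<$ (plus equality), with $\alpha>\beta$ iff $\alpha$ is a proper ancestor of $\beta$. The depth of a rooted tree is the maximum number of nodes on a root-to-leaf path. For $r\ge 2$, $t(r)$ is the maximum integer $z$ such that there is a first-order sentence with $r$ quantifiers (occurrences of $\forall,\exists$) true in all finite rooted trees of depth $\ge z$ and false in all finite rooted trees of depth $<z$. -}

module Defs where

open import Data.Nat using (ℕ; zero; suc; _+_; _≤_; _<_; _⊔_)
open import Data.Fin using (Fin)
open import Data.List using (List; []; _∷_)
open import Data.Product using (Σ; _×_; _,_; proj₁)
open import Data.Sum using (_⊎_)
open import Data.Unit using (⊤)
open import Data.Empty using (⊥)
open import Relation.Nullary using (¬_)
open import Relation.Binary.PropositionalEquality using (_≡_)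

-- Finite rooted trees (every finite rooted tree is isomorphic to one
-- of these; children are ordered, which is irrelevant for the
-- ancestor structure).

data Tree : Set where
  node : List Tree → Tree

-- Depth = maximum number of nodes on a root-to-leaf path.
mutual
  depth : Tree → ℕ
  depth (node ts) = suc (depthList ts)

  depthList : List Tree → ℕ
  depthList []       = 0
  depthList (t ∷ ts) = depth t ⊔ depthList ts

-- Nodes of a tree are addressed by paths of child indices from the root.
mutual
  ValidPath : Tree → List ℕ → Set
  ValidPath t         []      = ⊤
  ValidPath (node ts) (i ∷ p) = ValidChild ts i p

  ValidChild : List Tree → ℕ → List ℕ → Set
  ValidChild []       i       p = ⊥
  ValidChild (t ∷ ts) zero    p = ValidPath t p
  ValidChild (t ∷ ts) (suc i) p = ValidChild ts i p

Node : Tree → Set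
Node t = Σ (List ℕ) (ValidPath t)

data _⊏_ : List ℕ → List ℕ → Set where
  []⊏  : ∀ {x q} → [] ⊏ (x ∷ q)
  ∷⊏   : ∀ {x p q} → p ⊏ q → (x ∷ p) ⊏ (x ∷ q)

-- The structure's relation: α > β iff α is a proper ancestor of β,
-- i.e.  β < α  iff β is a proper descendant of α.
_<ᵀ_ : ∀ {t} → Node t → Node t → Set
β <ᵀ α = proj₁ α ⊏ proj₁ β

-- First-order formulas over the signature {<} with equality,
-- with n free variables (de Bruijn indices as Fin n).

data Formula (n : ℕ) : Set where
  _≺_  : Fin n → Fin n → Formula n
  _≐_  : Fin n → Fin n → Formula n
  ¬ᶠ_  : Formula n → Formula n
  _∧ᶠ_ : Formula n → Formula n → Formula n
  _∨ᶠ_ : Formula n → Formula n → Formula n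
  ∃ᶠ   : Formula (suc n) → Formula n
  ∀ᶠ   : Formula (suc n) → Formula n

Sentence : Set
Sentence = Formula 0

qcount : ∀ {n} → Formula n → ℕ
qcount (x ≺ y)   = 0
qcount (x ≐ y)   = 0
qcount (¬ᶠ φ)    = qcount φ
qcount (φ ∧ᶠ ψ)  = qcount φ + qcount ψ
qcount (φ ∨ᶠ ψ)  = qcount φ + qcount ψ
qcount (∃ᶠ φ)    = suc (qcount φ)
qcount (∀ᶠ φ)    = suc (qcount φ)

extend : ∀ {n} {A : Set} → A → (Fin n → A) → Fin (suc n) → A
extend a ρ Fin.zero    = a
extend a ρ (Fin.suc i) = ρ i

-- Satisfaction (finite domain, decidable atoms, so this agrees with the
-- classical semantics).
Sat : ∀ {n} (t : Tree) → (Fin n → Node t) → Formula n → Set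
Sat t ρ (x ≺ y)  = ρ x <ᵀ ρ y
Sat t ρ (x ≐ y)  = ρ x ≡ ρ y
Sat t ρ (¬ᶠ φ)   = ¬ Sat t ρ φ
Sat t ρ (φ ∧ᶠ ψ) = Sat t ρ φ × Sat t ρ ψ
Sat t ρ (φ ∨ᶠ ψ) = Sat t ρ φ ⊎ Sat t ρ ψ
Sat t ρ (∃ᶠ φ)   = Σ (Node t) λ a → Sat t (extend a ρ) φ
Sat t ρ (∀ᶠ φ)   = (a : Node t) → Sat t (extend a ρ) φ

noVars : ∀ {A : Set} → Fin 0 → A
noVars ()

_⊨_ : Tree → Sentence → Set
t ⊨ φ = Sat t noVars φ

DefinesDepth : ℕ → ℕ → Set
DefinesDepth r z =
  Σ Sentence λ φ →
    (qcount φ ≡ r) ×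
    ((t : Tree) → z ≤ depth t → t ⊨ φ) ×
    ((t : Tree) → depth t < z → ¬ (t ⊨ φ))

IsT : ℕ → ℕ → Set
IsT r z = DefinesDepth r z × ((z' : ℕ) → DefinesDepth r z' → z' ≤ z)

-- On a path the ancestor relation is a finite chain, so for the upper bound it
-- suffices that no sentence with three quantifiers separates the 4-chain from a
-- longer chain. The key fact: a formula with at most one quantifier, evaluated at
-- a tuple whose nonempty gaps are the union of those of two tuples inside it,
-- agrees with one of the two, since its single quantifier uses only one witness.
-- Hence a formula ψ(x) with two quantifiers sees only the numbers of nodes before
-- and after x, capped at 2. Besides the capped positions of the four nodes of the
-- 4-chain, a longer chain only has the middle position (2,2), and the same fact
-- shows that ψ agrees there with one of those four nodes. For the lower bound,
-- ∃x ∀y ∃z forces a chain of four nodes through x.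
module Submission where

open import Defs
open import Data.Bool using (Bool; true; false)
open import Data.Nat using (ℕ; zero; suc; _+_; _≤_; _<_; z≤n; s≤s; _<?_; _≟_)
open import Data.List using (List; []; _∷_; length; replicate; _++_)
open import Data.List.Properties using (length-replicate; ∷-injectiveˡ; ∷-injectiveʳ)
open import Data.Nat.Properties
  using ( ≤-trans; <-trans; <-cmp; <⇒≱; ≤-pred; ≤-reflexive; n<1+n; n≤0⇒n≡0; m<m+n; m+n≤o⇒m≤o; m+n≤o⇒n≤o
        ; +-comm; +-assoc; +-suc; +-identityʳ; +-cancelˡ-<; m≤n⇒∃[o]m+o≡n; m+n≡0⇒m≡0; m+n≡0⇒n≡0
        ; ⊔-identityʳ; ⊔-sel; m≤m⊔n; m≤n⊔m; anyUpTo?; allUpTo? )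
open import Data.Fin using (Fin; zero; suc)
open import Data.Product using (Σ; _×_; _,_; proj₁; proj₂; map₂)
open import Data.Sum using (_⊎_; inj₁; inj₂; reduce; [_,_]′)
open import Data.Empty using (⊥; ⊥-elim)
open import Data.Unit using (tt)
open import Function using (_∘_; id)
open import Function.Bundles using (_⇔_; mk⇔; Equivalence)
import Function.Properties.Equivalence as ⇔
open import Function.Related.TypeIsomorphisms using (¬-cong-⇔)
open import Data.Product.Function.NonDependent.Propositional using (_×-⇔_)
open import Data.Sum.Function.Propositional using (_⊎-⇔_)
open import Relation.Nullary using (¬_; Dec; yes; no)
open import Relation.Nullary.Decidable using (_×-dec_; _⊎-dec_; ¬?; map′; decidable-stable)
open import Relation.Binary using (tri<; tri≈; tri>)
open import Relation.Binary.PropositionalEquality using (_≡_; refl; sym; trans; cong; subst; subst₂)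

open Equivalence using (to; from)

<+suc : ∀ a b → a < a + suc b
<+suc a b = m<m+n a (s≤s z≤n)

0<⇒suc<+suc : ∀ a {b} → 0 < b → suc a < a + suc b
0<⇒suc<+suc a {b} 0<b = subst (suc (suc a) ≤_) (sym (+-suc a b)) (s≤s (m<m+n a 0<b))

between⇒0< : ∀ {a z b} → a < z → z < a + suc b → 0 < b
between⇒0< {a} {z} {zero}  a<z z<a+1 = ⊥-elim (<⇒≱ a<z (≤-pred (subst (z <_) (+-comm a 1) z<a+1)))
between⇒0< {b = suc b} _ _ = s≤s z≤n

<⇒+suc : ∀ {m n} → m < n → Σ ℕ λ o → m + suc o ≡ n
<⇒+suc {m} m<n with m≤n⇒∃[o]m+o≡n m<n
... | o , e = o , trans (+-suc m o) e

+≤1-cases : ∀ m {n} → m + n ≤ 1 → (m ≡ 0 × n ≤ 1) ⊎ (n ≡ 0 × m ≤ 1)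
+≤1-cases zero    h                 = inj₁ (refl , h)
+≤1-cases (suc m) {zero}  h         = inj₂ (refl , subst (_≤ 1) (+-identityʳ (suc m)) h)
+≤1-cases (suc zero)    {suc n} (s≤s ())
+≤1-cases (suc (suc m)) {suc n} (s≤s ())

+≤2-cases : ∀ m {n} → m + n ≤ 2 → (m ≡ 0 × n ≤ 2) ⊎ (n ≡ 0 × m ≤ 2) ⊎ (m ≤ 1 × n ≤ 1)
+≤2-cases zero               h = inj₁ (refl , h)
+≤2-cases (suc m) {zero}     h = inj₂ (inj₁ (refl , subst (_≤ 2) (+-identityʳ (suc m)) h))
+≤2-cases (suc zero) {suc zero} _ = inj₂ (inj₂ (s≤s z≤n , s≤s z≤n))
+≤2-cases (suc zero) {suc (suc n)} (s≤s (s≤s ()))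
+≤2-cases (suc (suc zero)) {suc n} (s≤s (s≤s ()))
+≤2-cases (suc (suc (suc m))) {suc n} (s≤s (s≤s ()))

data Comparison : Set where
  less equal greater : Comparison

opposite : Comparison → Comparison
opposite less    = greater
opposite equal   = equal
opposite greater = less

cmp : ℕ → ℕ → Comparison
cmp zero    zero    = equal
cmp zero    (suc _) = less
cmp (suc _) zero    = greater
cmp (suc m) (suc n) = cmp m n

cmp-refl : ∀ m → cmp m m ≡ equal
cmp-refl zero    = refl
cmp-refl (suc m) = cmp-refl m

cmp-< : ∀ {m n} → m < n → cmp m n ≡ less
cmp-< {zero}  {suc n} _       = refl
cmp-< {suc m} {suc n} (s≤s h) = cmp-< h

cmp-opposite : ∀ m n → cmp n m ≡ opposite (cmp m n)
cmp-opposite zero    zero    = refl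
cmp-opposite zero    (suc n) = refl
cmp-opposite (suc m) zero    = refl
cmp-opposite (suc m) (suc n) = cmp-opposite m n

cmp-> : ∀ {m n} → n < m → cmp m n ≡ greater
cmp-> {m} {n} h = trans (cmp-opposite n m) (cong opposite (cmp-< h))

cmp≡less⇒< : ∀ {m n} → cmp m n ≡ less → m < n
cmp≡less⇒< {zero}  {suc n} _ = s≤s z≤n
cmp≡less⇒< {suc m} {suc n} h = s≤s (cmp≡less⇒< h)
cmp≡less⇒< {zero}  {zero}  ()
cmp≡less⇒< {suc m} {zero}  ()

cmp≡equal⇒≡ : ∀ {m n} → cmp m n ≡ equal → m ≡ n
cmp≡equal⇒≡ {zero}  {zero}  _ = refl
cmp≡equal⇒≡ {suc m} {suc n} h = cong suc (cmp≡equal⇒≡ h)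
cmp≡equal⇒≡ {zero}  {suc n} ()
cmp≡equal⇒≡ {suc m} {zero}  ()

≡⇒cmp≡equal : ∀ {m n} → m ≡ n → cmp m n ≡ equal
≡⇒cmp≡equal {m} refl = cmp-refl m

-- Truth in the chain 0 < 1 < ⋯ < N-1: node i plays the node at depth i of
-- a path, so x ≺ y (x a proper descendant of y) becomes ρ y < ρ x.
Holds : ℕ → ∀ {n} → (Fin n → ℕ) → Formula n → Set
Holds N ρ (x ≺ y)  = ρ y < ρ x
Holds N ρ (x ≐ y)  = ρ x ≡ ρ y
Holds N ρ (¬ᶠ φ)   = ¬ Holds N ρ φ
Holds N ρ (φ ∧ᶠ ψ) = Holds N ρ φ × Holds N ρ ψ
Holds N ρ (φ ∨ᶠ ψ) = Holds N ρ φ ⊎ Holds N ρ ψ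
Holds N ρ (∃ᶠ φ)   = Σ ℕ λ z → z < N × Holds N (extend z ρ) φ
Holds N ρ (∀ᶠ φ)   = (z : ℕ) → z < N → Holds N (extend z ρ) φ

holds? : ∀ N {n} (ρ : Fin n → ℕ) φ → Dec (Holds N ρ φ)
holds? N ρ (x ≺ y)  = ρ y <? ρ x
holds? N ρ (x ≐ y)  = ρ x ≟ ρ y
holds? N ρ (¬ᶠ φ)   = ¬? (holds? N ρ φ)
holds? N ρ (φ ∧ᶠ ψ) = holds? N ρ φ ×-dec holds? N ρ ψ
holds? N ρ (φ ∨ᶠ ψ) = holds? N ρ φ ⊎-dec holds? N ρ ψ
holds? N ρ (∃ᶠ φ)   = anyUpTo? (λ z → holds? N (extend z ρ) φ) N
holds? N ρ (∀ᶠ φ)   = map′ (λ h z → h {z}) (λ h {z} → h z) (allUpTo? (λ z → holds? N (extend z ρ) φ) N)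

∀-as-¬∃¬ : ∀ N {n} (ρ : Fin n → ℕ) φ → Holds N ρ (∀ᶠ φ) ⇔ Holds N ρ (¬ᶠ (∃ᶠ (¬ᶠ φ)))
∀-as-¬∃¬ N ρ φ = mk⇔ (λ h (z , z<N , ¬h) → ¬h (h z z<N))
                     (λ ¬∃ z z<N → decidable-stable (holds? N (extend z ρ) φ) (λ ¬h → ¬∃ (z , z<N , ¬h)))

∀ᶠ-cong : ∀ {n} (θ : Formula (suc n)) {N M} {ρ σ : Fin n → ℕ} →
          Holds N ρ (∃ᶠ (¬ᶠ θ)) ⇔ Holds M σ (∃ᶠ (¬ᶠ θ)) → Holds N ρ (∀ᶠ θ) ⇔ Holds M σ (∀ᶠ θ)
∀ᶠ-cong θ {N} {M} {ρ} {σ} e = ⇔.trans (∀-as-¬∃¬ N ρ θ) (⇔.trans (¬-cong-⇔ e) (⇔.sym (∀-as-¬∃¬ M σ θ)))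

record SameCmp {n} (ρ σ : Fin n → ℕ) : Set where
  constructor sameCmp
  field cmp-≡ : ∀ u v → cmp (ρ u) (ρ v) ≡ cmp (σ u) (σ v)
open SameCmp

sameCmp-sym : ∀ {n} {ρ σ : Fin n → ℕ} → SameCmp ρ σ → SameCmp σ ρ
sameCmp-sym s = sameCmp λ u v → sym (cmp-≡ s u v)

extend-sameCmp : ∀ {n} {ρ σ : Fin n → ℕ} {z z'} → SameCmp ρ σ →
                 (∀ v → cmp z (ρ v) ≡ cmp z' (σ v)) → SameCmp (extend z ρ) (extend z' σ)
extend-sameCmp {ρ = ρ} {σ} {z} {z'} s m = sameCmp λ where
  zero    zero    → trans (cmp-refl z) (sym (cmp-refl z'))
  zero    (suc v) → m v
  (suc u) zero    → trans (cmp-opposite z (ρ u)) (trans (cong opposite (m u)) (sym (cmp-opposite z' (σ u))))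
  (suc u) (suc v) → cmp-≡ s u v

point : ℕ → Fin 1 → ℕ
point x = extend x noVars

point-sameCmp : ∀ x x' → SameCmp (point x) (point x')
point-sameCmp x x' = sameCmp λ { zero zero → trans (cmp-refl x) (sym (cmp-refl x')) }

qfree-transfer : ∀ {n} (φ : Formula n) → qcount φ ≡ 0 → ∀ {N M} {ρ σ : Fin n → ℕ} →
                 SameCmp ρ σ → Holds N ρ φ → Holds M σ φ
qfree-transfer (x ≺ y)  _ s h = cmp≡less⇒< (trans (sym (cmp-≡ s y x)) (cmp-< h))
qfree-transfer (x ≐ y)  _ s h = cmp≡equal⇒≡ (trans (sym (cmp-≡ s x y)) (≡⇒cmp≡equal h))
qfree-transfer (¬ᶠ φ)   e s h = λ h' → h (qfree-transfer φ e (sameCmp-sym s) h')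
qfree-transfer (φ ∧ᶠ ψ) e s (h , h') =
  qfree-transfer φ (m+n≡0⇒m≡0 (qcount φ) e) s h , qfree-transfer ψ (m+n≡0⇒n≡0 (qcount φ) e) s h'
qfree-transfer (φ ∨ᶠ ψ) e s (inj₁ h) = inj₁ (qfree-transfer φ (m+n≡0⇒m≡0 (qcount φ) e) s h)
qfree-transfer (φ ∨ᶠ ψ) e s (inj₂ h) = inj₂ (qfree-transfer ψ (m+n≡0⇒n≡0 (qcount φ) e) s h)
qfree-transfer (∃ᶠ φ)   () s h
qfree-transfer (∀ᶠ φ)   () s h

qfree-cong : ∀ {n} (φ : Formula n) → qcount φ ≡ 0 → ∀ {N M} {ρ σ : Fin n → ℕ} →
             SameCmp ρ σ → Holds N ρ φ ⇔ Holds M σ φ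
qfree-cong φ e s = mk⇔ (qfree-transfer φ e s) (qfree-transfer φ e (sameCmp-sym s))

Counterpart : ∀ {n} → (Fin n → ℕ) → ℕ → ℕ → (Fin n → ℕ) → Set
Counterpart ρ z M σ = Σ ℕ λ z' → z' < M × SameCmp (extend z ρ) (extend z' σ)

Embeds : ∀ {n} → ℕ → (Fin n → ℕ) → ℕ → (Fin n → ℕ) → Set
Embeds N ρ M σ = ∀ z → z < N → Counterpart ρ z M σ

Covered : ∀ {n} → ℕ → (Fin n → ℕ) → ℕ → (Fin n → ℕ) → ℕ → (Fin n → ℕ) → Set
Covered N ρ M₁ σ₁ M₂ σ₂ = ∀ z → z < N → Counterpart ρ z M₁ σ₁ ⊎ Counterpart ρ z M₂ σ₂

∃-transfer : ∀ {n} (χ : Formula (suc n)) → qcount χ ≡ 0 → ∀ {N M} {ρ σ : Fin n → ℕ} →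
             Embeds N ρ M σ → Holds N ρ (∃ᶠ χ) → Holds M σ (∃ᶠ χ)
∃-transfer χ e emb (z , z<N , h) with emb z z<N
... | z' , z'<M , s = z' , z'<M , qfree-transfer χ e s h

-- A single existential can only use one witness, so it cannot tell ρ
-- apart from both of two approximations that together cover ρ.
∃-split : ∀ {n} (χ : Formula (suc n)) → qcount χ ≡ 0 → ∀ {N M₁ M₂} {ρ σ₁ σ₂ : Fin n → ℕ} →
          Embeds M₁ σ₁ N ρ → Embeds M₂ σ₂ N ρ → Covered N ρ M₁ σ₁ M₂ σ₂ →
          (Holds N ρ (∃ᶠ χ) ⇔ Holds M₁ σ₁ (∃ᶠ χ)) ⊎ (Holds N ρ (∃ᶠ χ) ⇔ Holds M₂ σ₂ (∃ᶠ χ))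
∃-split χ e {N} {ρ = ρ} e₁ e₂ c with holds? N ρ (∃ᶠ χ)
... | yes w@(z , z<N , h) = Data.Sum.map witnessed witnessed (c z z<N)
  where
  witnessed : ∀ {M σ} → Counterpart ρ z M σ → Holds N ρ (∃ᶠ χ) ⇔ Holds M σ (∃ᶠ χ)
  witnessed (z' , z'<M , s) = mk⇔ (λ _ → z' , z'<M , qfree-transfer χ e s h) (λ _ → w)
... | no ¬w = inj₁ (mk⇔ (⊥-elim ∘ ¬w) (∃-transfer χ e e₁))

count≤1-split : ∀ {n} (θ : Formula n) → qcount θ ≤ 1 → ∀ {N M₁ M₂} {ρ σ₁ σ₂ : Fin n → ℕ} →
  SameCmp ρ σ₁ → SameCmp ρ σ₂ → Embeds M₁ σ₁ N ρ → Embeds M₂ σ₂ N ρ → Covered N ρ M₁ σ₁ M₂ σ₂ →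
  (Holds N ρ θ ⇔ Holds M₁ σ₁ θ) ⊎ (Holds N ρ θ ⇔ Holds M₂ σ₂ θ)
count≤1-split (x ≺ y) _ {N} {M₁} s₁ s₂ e₁ e₂ c = inj₁ (qfree-cong (x ≺ y) refl {N} {M₁} s₁)
count≤1-split (x ≐ y) _ {N} {M₁} s₁ s₂ e₁ e₂ c = inj₁ (qfree-cong (x ≐ y) refl {N} {M₁} s₁)
count≤1-split (¬ᶠ θ)  q s₁ s₂ e₁ e₂ c = Data.Sum.map ¬-cong-⇔ ¬-cong-⇔ (count≤1-split θ q s₁ s₂ e₁ e₂ c)
count≤1-split (θ ∧ᶠ θ') q s₁ s₂ e₁ e₂ c with +≤1-cases (qcount θ) q
... | inj₁ (z , q') =
  Data.Sum.map (qfree-cong θ z s₁ ×-⇔_) (qfree-cong θ z s₂ ×-⇔_) (count≤1-split θ' q' s₁ s₂ e₁ e₂ c)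
... | inj₂ (z , q') =
  Data.Sum.map (_×-⇔ qfree-cong θ' z s₁) (_×-⇔ qfree-cong θ' z s₂) (count≤1-split θ q' s₁ s₂ e₁ e₂ c)
count≤1-split (θ ∨ᶠ θ') q s₁ s₂ e₁ e₂ c with +≤1-cases (qcount θ) q
... | inj₁ (z , q') =
  Data.Sum.map (qfree-cong θ z s₁ ⊎-⇔_) (qfree-cong θ z s₂ ⊎-⇔_) (count≤1-split θ' q' s₁ s₂ e₁ e₂ c)
... | inj₂ (z , q') =
  Data.Sum.map (_⊎-⇔ qfree-cong θ' z s₁) (_⊎-⇔ qfree-cong θ' z s₂) (count≤1-split θ q' s₁ s₂ e₁ e₂ c)
count≤1-split (∃ᶠ χ) (s≤s q) s₁ s₂ e₁ e₂ c = ∃-split χ (n≤0⇒n≡0 q) e₁ e₂ c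
count≤1-split (∀ᶠ χ) (s≤s q) s₁ s₂ e₁ e₂ c =
  Data.Sum.map (∀ᶠ-cong χ) (∀ᶠ-cong χ) (∃-split (¬ᶠ χ) (n≤0⇒n≡0 q) e₁ e₂ c)

Match₁ : ℕ → ℕ → ℕ → ℕ → Set
Match₁ z p M p' = Σ ℕ λ z' → z' < M × cmp z p ≡ cmp z' p'

Match₂ : ℕ → ℕ → ℕ → ℕ → ℕ → ℕ → Set
Match₂ z p q M p' q' = Σ ℕ λ z' → z' < M × cmp z p ≡ cmp z' p' × cmp z q ≡ cmp z' q'

point-cover : ∀ {a c a₁ c₁ a₂ c₂} → (0 < a → 0 < a₁ ⊎ 0 < a₂) → (0 < c → 0 < c₁ ⊎ 0 < c₂) →
              ∀ z → z < a + suc c → Match₁ z a (a₁ + suc c₁) a₁ ⊎ Match₁ z a (a₂ + suc c₂) a₂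
point-cover {a} {c} {a₁} {c₁} {a₂} {c₂} ha hc z z<N with <-cmp z a
... | tri< z<a _ _ = Data.Sum.map (before a₁ c₁) (before a₂ c₂) (ha (≤-trans (s≤s z≤n) z<a))
  where
  before : ∀ a' c' → 0 < a' → Match₁ z a (a' + suc c') a'
  before a' c' 0<a' = 0 , <-trans 0<a' (<+suc a' c') , trans (cmp-< z<a) (sym (cmp-< 0<a'))
... | tri≈ _ refl _ = inj₁ (a₁ , <+suc a₁ c₁ , trans (cmp-refl z) (sym (cmp-refl a₁)))
... | tri> _ _ a<z = Data.Sum.map (after a₁ c₁) (after a₂ c₂) (hc (between⇒0< a<z z<N))
  where
  after : ∀ a' c' → 0 < c' → Match₁ z a (a' + suc c') a'
  after a' c' 0<c' = suc a' , 0<⇒suc<+suc a' 0<c' , trans (cmp-> a<z) (sym (cmp-> (n<1+n a')))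

-- The marked nodes are a and a + suc b; a, b and c are the gaps before, between and after them.
pair-cover : ∀ {a b c a₁ b₁ c₁ a₂ b₂ c₂} →
  (0 < a → 0 < a₁ ⊎ 0 < a₂) → (0 < b → 0 < b₁ ⊎ 0 < b₂) → (0 < c → 0 < c₁ ⊎ 0 < c₂) →
  ∀ z → z < a + suc b + suc c →
  Match₂ z a (a + suc b) (a₁ + suc b₁ + suc c₁) a₁ (a₁ + suc b₁) ⊎
  Match₂ z a (a + suc b) (a₂ + suc b₂ + suc c₂) a₂ (a₂ + suc b₂)
pair-cover {a} {b} {c} {a₁} {b₁} {c₁} {a₂} {b₂} {c₂} ha hb hc z z<N with <-cmp z a
... | tri< z<a _ _ = Data.Sum.map (gap₀ a₁ b₁ c₁) (gap₀ a₂ b₂ c₂) (ha (≤-trans (s≤s z≤n) z<a))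
  where
  gap₀ : ∀ a' b' c' → 0 < a' → Match₂ z a (a + suc b) (a' + suc b' + suc c') a' (a' + suc b')
  gap₀ a' b' c' 0<a' = 0 , <-trans (<-trans 0<a' (<+suc a' b')) (<+suc _ c') ,
    trans (cmp-< z<a) (sym (cmp-< 0<a')) ,
    trans (cmp-< (<-trans z<a (<+suc a b))) (sym (cmp-< (<-trans 0<a' (<+suc a' b'))))
... | tri≈ _ refl _ = inj₁ (a₁ , <-trans (<+suc a₁ b₁) (<+suc _ c₁) ,
    trans (cmp-refl z) (sym (cmp-refl a₁)) , trans (cmp-< (<+suc z b)) (sym (cmp-< (<+suc a₁ b₁))))
... | tri> _ _ a<z with <-cmp z (a + suc b)
...   | tri< z<q _ _ = Data.Sum.map (gap₁ a₁ b₁ c₁) (gap₁ a₂ b₂ c₂) (hb (between⇒0< a<z z<q))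
  where
  gap₁ : ∀ a' b' c' → 0 < b' → Match₂ z a (a + suc b) (a' + suc b' + suc c') a' (a' + suc b')
  gap₁ a' b' c' 0<b' = suc a' , <-trans (0<⇒suc<+suc a' 0<b') (<+suc _ c') ,
    trans (cmp-> a<z) (sym (cmp-> (n<1+n a'))) , trans (cmp-< z<q) (sym (cmp-< (0<⇒suc<+suc a' 0<b')))
...   | tri≈ _ refl _ = inj₁ (a₁ + suc b₁ , <+suc _ c₁ ,
    trans (cmp-> (<+suc a b)) (sym (cmp-> (<+suc a₁ b₁))) , trans (cmp-refl z) (sym (cmp-refl (a₁ + suc b₁))))
...   | tri> _ _ q<z = Data.Sum.map (gap₂ a₁ b₁ c₁) (gap₂ a₂ b₂ c₂) (hc (between⇒0< q<z z<N))
  where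
  gap₂ : ∀ a' b' c' → 0 < c' → Match₂ z a (a + suc b) (a' + suc b' + suc c') a' (a' + suc b')
  gap₂ a' b' c' 0<c' = suc (a' + suc b') , 0<⇒suc<+suc _ 0<c' ,
    trans (cmp-> (<-trans (<+suc a b) q<z)) (sym (cmp-> (<-trans (<+suc a' b') (n<1+n _)))) ,
    trans (cmp-> q<z) (sym (cmp-> (n<1+n (a' + suc b'))))

pair-sameCmp : ∀ {y x y' x'} → cmp y x ≡ cmp y' x' → SameCmp (extend y (point x)) (extend y' (point x'))
pair-sameCmp {y} {x} {y'} {x'} o = extend-sameCmp (point-sameCmp x x') λ { zero → o }

pair-counterpart : ∀ {y x y' x' z z'} → cmp y x ≡ cmp y' x' → cmp z y ≡ cmp z' y' → cmp z x ≡ cmp z' x' →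
                   SameCmp (extend z (extend y (point x))) (extend z' (extend y' (point x')))
pair-counterpart o my mx = extend-sameCmp (pair-sameCmp o) λ { zero → my ; (suc zero) → mx }

point-counterpart : ∀ {x x' z M} → Match₁ z x M x' → Counterpart (point x) z M (point x')
point-counterpart {x} {x'} (z' , z'<M , m) = z' , z'<M , extend-sameCmp (point-sameCmp x x') λ { zero → m }

below-counterpart : ∀ {a b a' b' z M} → Match₂ z a (a + suc b) M a' (a' + suc b') →
                    Counterpart (extend a (point (a + suc b))) z M (extend a' (point (a' + suc b')))
below-counterpart {a} {b} {a'} {b'} (z' , z'<M , m₀ , m₁) =
  z' , z'<M , pair-counterpart (trans (cmp-< (<+suc a b)) (sym (cmp-< (<+suc a' b')))) m₀ m₁

above-counterpart : ∀ {a b a' b' z M} → Match₂ z a (a + suc b) M a' (a' + suc b') →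
                    Counterpart (extend (a + suc b) (point a)) z M (extend (a' + suc b') (point a'))
above-counterpart {a} {b} {a'} {b'} (z' , z'<M , m₀ , m₁) =
  z' , z'<M , pair-counterpart (trans (cmp-> (<+suc a b)) (sym (cmp-> (<+suc a' b')))) m₁ m₀

equal-counterpart : ∀ {a a' z M} → Match₁ z a M a' → Counterpart (extend a (point a)) z M (extend a' (point a'))
equal-counterpart {a} {a'} (z' , z'<M , m) = z' , z'<M , pair-counterpart (trans (cmp-refl a) (sym (cmp-refl a'))) m m

data Arrangement (A : Set) : Set where
  below : A → A → A → Arrangement A
  equal : A → A → Arrangement A
  above : A → A → A → Arrangement A

-- A pair (x , y) of nodes of a chain, described by the sizes of the gaps
-- around it: below a b c is a nodes, y, b nodes, x, c nodes; above a b c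
-- is the same with x and y exchanged; equal a c is a nodes, x = y, c nodes.
-- In formulas, variable 0 is y and variable 1 is x.
Pair : Set
Pair = Arrangement ℕ

size : Pair → ℕ
size (below a b c) = a + suc b + suc c
size (equal a c)   = a + suc c
size (above a b c) = a + suc b + suc c

assignment : Pair → Fin 2 → ℕ
assignment (below a b c) = extend a (point (a + suc b))
assignment (equal a c)   = extend a (point a)
assignment (above a b c) = extend (a + suc b) (point a)

_⟪_⟫ : Formula 2 → Pair → Set
θ ⟪ p ⟫ = Holds (size p) (assignment p) θ

occupied : ℕ → Bool
occupied zero    = false
occupied (suc _) = true

Shape : Set
Shape = Arrangement Bool

shape : Pair → Shape
shape (below a b c) = below (occupied a) (occupied b) (occupied c)
shape (equal a c)   = equal (occupied a) (occupied c)
shape (above a b c) = above (occupied a) (occupied b) (occupied c)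

-- Split b b₁ b₂ : b₁ and b₂ are below b and b is below b₁ ∨ b₂.
data Split : Bool → Bool → Bool → Set where
  both  : ∀ {b} → Split b b b
  left  : Split true true false
  right : Split true false true

ShapeSplit : Shape → Shape → Shape → Set
ShapeSplit (below u v w) (below u₁ v₁ w₁) (below u₂ v₂ w₂) = Split u u₁ u₂ × Split v v₁ v₂ × Split w w₁ w₂
ShapeSplit (equal u w)   (equal u₁ w₁)    (equal u₂ w₂)    = Split u u₁ u₂ × Split w w₁ w₂
ShapeSplit (above u v w) (above u₁ v₁ w₁) (above u₂ v₂ w₂) = Split u u₁ u₂ × Split v v₁ v₂ × Split w w₁ w₂
ShapeSplit _ _ _ = ⊥

shapeSplit-refl : ∀ s → ShapeSplit s s s
shapeSplit-refl (below u v w) = both , both , both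
shapeSplit-refl (equal u w)   = both , both
shapeSplit-refl (above u v w) = both , both , both

split-covers : ∀ {a a₁ a₂} → Split (occupied a) (occupied a₁) (occupied a₂) → 0 < a → 0 < a₁ ⊎ 0 < a₂
split-covers {suc _} {suc _}          _  _ = inj₁ (s≤s z≤n)
split-covers {suc _} {zero} {suc _}   _  _ = inj₂ (s≤s z≤n)
split-covers {suc _} {zero} {zero}    () _

split-left : ∀ {a a₁ a₂} → Split (occupied a) (occupied a₁) (occupied a₂) → 0 < a₁ → 0 < a
split-left {suc _}          _  _ = s≤s z≤n
split-left {zero} {suc _} {zero}  () _
split-left {zero} {suc _} {suc _} () _

split-right : ∀ {a a₁ a₂} → Split (occupied a) (occupied a₁) (occupied a₂) → 0 < a₂ → 0 < a
split-right {suc _}                  _  _ = s≤s z≤n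
split-right {zero} {zero}  {suc _}   () _
split-right {zero} {suc _} {suc _}   () _

holds-split : ∀ θ → qcount θ ≤ 1 → ∀ p p₁ p₂ → ShapeSplit (shape p) (shape p₁) (shape p₂) →
              (θ ⟪ p ⟫ ⇔ θ ⟪ p₁ ⟫) ⊎ (θ ⟪ p ⟫ ⇔ θ ⟪ p₂ ⟫)
holds-split θ q (below a b c) (below a₁ b₁ c₁) (below a₂ b₂ c₂) (sa , sb , sc) =
  count≤1-split θ q
    (pair-sameCmp (trans (cmp-< (<+suc a b)) (sym (cmp-< (<+suc a₁ b₁)))))
    (pair-sameCmp (trans (cmp-< (<+suc a b)) (sym (cmp-< (<+suc a₂ b₂)))))
    (λ z l → below-counterpart (reduce (pair-cover (inj₁ ∘ split-left sa) (inj₁ ∘ split-left sb) (inj₁ ∘ split-left sc) z l)))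
    (λ z l → below-counterpart (reduce (pair-cover (inj₁ ∘ split-right sa) (inj₁ ∘ split-right sb) (inj₁ ∘ split-right sc) z l)))
    (λ z l → Data.Sum.map below-counterpart below-counterpart (pair-cover (split-covers sa) (split-covers sb) (split-covers sc) z l))
holds-split θ q (equal a c) (equal a₁ c₁) (equal a₂ c₂) (sa , sc) =
  count≤1-split θ q
    (pair-sameCmp (trans (cmp-refl a) (sym (cmp-refl a₁))))
    (pair-sameCmp (trans (cmp-refl a) (sym (cmp-refl a₂))))
    (λ z l → equal-counterpart (reduce (point-cover (inj₁ ∘ split-left sa) (inj₁ ∘ split-left sc) z l)))
    (λ z l → equal-counterpart (reduce (point-cover (inj₁ ∘ split-right sa) (inj₁ ∘ split-right sc) z l)))
    (λ z l → Data.Sum.map equal-counterpart equal-counterpart (point-cover (split-covers sa) (split-covers sc) z l))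
holds-split θ q (above a b c) (above a₁ b₁ c₁) (above a₂ b₂ c₂) (sa , sb , sc) =
  count≤1-split θ q
    (pair-sameCmp (trans (cmp-> (<+suc a b)) (sym (cmp-> (<+suc a₁ b₁)))))
    (pair-sameCmp (trans (cmp-> (<+suc a b)) (sym (cmp-> (<+suc a₂ b₂)))))
    (λ z l → above-counterpart (reduce (pair-cover (inj₁ ∘ split-left sa) (inj₁ ∘ split-left sb) (inj₁ ∘ split-left sc) z l)))
    (λ z l → above-counterpart (reduce (pair-cover (inj₁ ∘ split-right sa) (inj₁ ∘ split-right sb) (inj₁ ∘ split-right sc) z l)))
    (λ z l → Data.Sum.map above-counterpart above-counterpart (pair-cover (split-covers sa) (split-covers sb) (split-covers sc) z l))

holds-cong : ∀ θ → qcount θ ≤ 1 → ∀ p p' → shape p ≡ shape p' → θ ⟪ p ⟫ ⇔ θ ⟪ p' ⟫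
holds-cong θ q p p' e =
  reduce (holds-split θ q p p' p' (subst (λ s → ShapeSplit s (shape p') (shape p')) (sym e) (shapeSplit-refl (shape p'))))

holds-move : ∀ θ → qcount θ ≤ 1 → ∀ p p' → shape p ≡ shape p' → θ ⟪ p ⟫ → θ ⟪ p' ⟫
holds-move θ q p p' e = to (holds-cong θ q p p' e)

_⟨_⟩ : Formula 1 → ℕ × ℕ → Set
ψ ⟨ l , r ⟩ = Holds (l + suc r) (point l) ψ

qfree-point-cong : ∀ ψ → qcount ψ ≡ 0 → ∀ {l r l' r'} → ψ ⟨ l , r ⟩ ⇔ ψ ⟨ l' , r' ⟩
qfree-point-cong ψ e {l} {r} {l'} {r'} = qfree-cong ψ e {l + suc r} {l' + suc r'} (point-sameCmp l l')

occupied-≡⇒ : ∀ {a a'} → occupied a ≡ occupied a' → 0 < a → 0 < a'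
occupied-≡⇒ {suc _} {suc _} _  _ = s≤s z≤n
occupied-≡⇒ {suc _} {zero}  () _

count≤1-point-cong : ∀ ψ → qcount ψ ≤ 1 → ∀ {l r l' r'} → occupied l ≡ occupied l' → occupied r ≡ occupied r' →
                     ψ ⟨ l , r ⟩ ⇔ ψ ⟨ l' , r' ⟩
count≤1-point-cong ψ q {l} {r} {l'} {r'} el er =
  reduce (count≤1-split ψ q (point-sameCmp l l') (point-sameCmp l l') embeds embeds
           (λ z z<N → inj₁ (point-counterpart (reduce (point-cover (inj₁ ∘ occupied-≡⇒ el) (inj₁ ∘ occupied-≡⇒ er) z z<N)))))
  where
  embeds : Embeds (l' + suc r') (point l') (l + suc r) (point l)
  embeds z z<N = point-counterpart (reduce (point-cover (inj₁ ∘ occupied-≡⇒ (sym el)) (inj₁ ∘ occupied-≡⇒ (sym er)) z z<N))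

Below : Formula 2 → ℕ → ℕ → Set
Below θ l r = Σ ℕ λ a → Σ ℕ λ b → a + suc b ≡ l × θ ⟪ below a b r ⟫

Above : Formula 2 → ℕ → ℕ → Set
Above θ l r = Σ ℕ λ b → Σ ℕ λ c → b + suc c ≡ r × θ ⟪ above l b c ⟫

below-at : ∀ θ {a b r} → θ ⟪ below a b r ⟫ → (∃ᶠ θ) ⟨ a + suc b , r ⟩
below-at θ {a} {b} {r} h = a , <-trans (<+suc a b) (<+suc _ r) , h

equal-at : ∀ θ {l r} → θ ⟪ equal l r ⟫ → (∃ᶠ θ) ⟨ l , r ⟩
equal-at θ {l} {r} h = l , <+suc l r , h

above-at : ∀ θ {l b c} → θ ⟪ above l b c ⟫ → (∃ᶠ θ) ⟨ l , b + suc c ⟩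
above-at θ {l} {b} {c} h =
  l + suc b , subst (l + suc b <_) (+-assoc l (suc b) (suc c)) (<+suc _ c) ,
  subst (λ N → Holds N (extend (l + suc b) (point l)) θ) (+-assoc l (suc b) (suc c)) h

at-below : ∀ θ {y b l r} → y + suc b ≡ l → Holds (l + suc r) (extend y (point l)) θ → θ ⟪ below y b r ⟫
at-below θ refl h = h

at-above : ∀ θ {l b c y r} → l + suc b ≡ y → b + suc c ≡ r → Holds (l + suc r) (extend y (point l)) θ → θ ⟪ above l b c ⟫
at-above θ {l} {b} {c} refl refl h = subst (λ N → Holds N (extend (l + suc b) (point l)) θ) (sym (+-assoc l (suc b) (suc c))) h

∃-partners : ∀ θ l r → (∃ᶠ θ) ⟨ l , r ⟩ ⇔ (Below θ l r ⊎ θ ⟪ equal l r ⟫ ⊎ Above θ l r)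
∃-partners θ l r = mk⇔ partner (λ { (inj₁ (a , b , e , h)) → subst (λ l → (∃ᶠ θ) ⟨ l , r ⟩) e (below-at θ h)
                                  ; (inj₂ (inj₁ h)) → equal-at θ h
                                  ; (inj₂ (inj₂ (b , c , e , h))) → subst (λ r → (∃ᶠ θ) ⟨ l , r ⟩) e (above-at θ h) })
  where
  partner : (∃ᶠ θ) ⟨ l , r ⟩ → Below θ l r ⊎ θ ⟪ equal l r ⟫ ⊎ Above θ l r
  partner (y , y<N , h) with <-cmp y l
  ... | tri< y<l _ _ = let b , e = <⇒+suc y<l in inj₁ (y , b , e , at-below θ e h)
  ... | tri≈ _ refl _ = inj₂ (inj₁ h)
  ... | tri> _ _ l<y =
    let b , e₁ = <⇒+suc l<y
        c , e₂ = <⇒+suc (≤-pred (+-cancelˡ-< l (suc b) (suc r) (subst (_< l + suc r) (sym e₁) y<N)))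
    in inj₂ (inj₂ (b , c , e₂ , at-above θ e₁ e₂ h))

-- Shrinking loses only partners y with nonempty gaps on both of their sides
-- inside the left part; holds-split trades such a y for the first node or
-- for the node next to x.
below-shrink : ∀ θ → qcount θ ≤ 1 → ∀ l r → Below θ (3 + l) r ⇔ Below θ (2 + l) r
below-shrink θ q l r = mk⇔ shrink grow
  where
  move : ∀ p p' → shape p ≡ shape p' → θ ⟪ p ⟫ → θ ⟪ p' ⟫
  move = holds-move θ q
  shrink : Below θ (3 + l) r → Below θ (2 + l) r
  shrink (zero , b , refl , h) = 0 , suc l , refl , move (below 0 b r) (below 0 (suc l) r) refl h
  shrink (suc a , zero , e , h) = suc l , 0 , +-comm (suc l) 1 , move (below (suc a) 0 r) (below (suc l) 0 r) refl h
  shrink (suc a , suc b , e , h) with holds-split θ q (below (suc a) (suc b) r) (below 0 (suc l) r) (below (suc l) 0 r) (right , left , both)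
  ... | inj₁ e₁ = 0 , suc l , refl , to e₁ h
  ... | inj₂ e₂ = suc l , 0 , +-comm (suc l) 1 , to e₂ h
  grow : Below θ (2 + l) r → Below θ (3 + l) r
  grow (suc a , zero , e , h) = suc (suc a) , 0 , cong suc e , move (below (suc a) 0 r) (below (suc (suc a)) 0 r) refl h
  grow (a , suc b , e , h) = a , suc (suc b) , trans (+-suc a (suc (suc b))) (cong suc e) , move (below a (suc b) r) (below a (suc (suc b)) r) refl h

above-shrink : ∀ θ → qcount θ ≤ 1 → ∀ l r → Above θ l (3 + r) ⇔ Above θ l (2 + r)
above-shrink θ q l r = mk⇔ shrink grow
  where
  move : ∀ p p' → shape p ≡ shape p' → θ ⟪ p ⟫ → θ ⟪ p' ⟫
  move = holds-move θ q
  shrink : Above θ l (3 + r) → Above θ l (2 + r)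
  shrink (zero , c , refl , h) = 0 , suc r , refl , move (above l 0 c) (above l 0 (suc r)) refl h
  shrink (suc b , zero , e , h) = suc r , 0 , +-comm (suc r) 1 , move (above l (suc b) 0) (above l (suc r) 0) refl h
  shrink (suc b , suc c , e , h) with holds-split θ q (above l (suc b) (suc c)) (above l 0 (suc r)) (above l (suc r) 0) (both , right , left)
  ... | inj₁ e₁ = 0 , suc r , refl , to e₁ h
  ... | inj₂ e₂ = suc r , 0 , +-comm (suc r) 1 , to e₂ h
  grow : Above θ l (2 + r) → Above θ l (3 + r)
  grow (suc b , zero , e , h) = suc (suc b) , 0 , cong suc e , move (above l (suc b) 0) (above l (suc (suc b)) 0) refl h
  grow (b , suc c , e , h) = b , suc (suc c) , trans (+-suc b (suc (suc c))) (cong suc e) , move (above l b (suc c)) (above l b (suc (suc c))) refl h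

∃-shrink-left : ∀ θ → qcount θ ≤ 1 → ∀ l r → (∃ᶠ θ) ⟨ 3 + l , r ⟩ ⇔ (∃ᶠ θ) ⟨ 2 + l , r ⟩
∃-shrink-left θ q l r =
  ⇔.trans (∃-partners θ (3 + l) r)
    (⇔.trans (below-shrink θ q l r ⊎-⇔ (holds-cong θ q (equal (3 + l) r) (equal (2 + l) r) refl ⊎-⇔ above-part))
      (⇔.sym (∃-partners θ (2 + l) r)))
  where
  above-part : Above θ (3 + l) r ⇔ Above θ (2 + l) r
  above-part = mk⇔ (λ (b , c , e , h) → b , c , e , to (holds-cong θ q (above (3 + l) b c) (above (2 + l) b c) refl) h)
                   (λ (b , c , e , h) → b , c , e , from (holds-cong θ q (above (3 + l) b c) (above (2 + l) b c) refl) h)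

∃-shrink-right : ∀ θ → qcount θ ≤ 1 → ∀ l r → (∃ᶠ θ) ⟨ l , 3 + r ⟩ ⇔ (∃ᶠ θ) ⟨ l , 2 + r ⟩
∃-shrink-right θ q l r =
  ⇔.trans (∃-partners θ l (3 + r))
    (⇔.trans (below-part ⊎-⇔ (holds-cong θ q (equal l (3 + r)) (equal l (2 + r)) refl ⊎-⇔ above-shrink θ q l r))
      (⇔.sym (∃-partners θ l (2 + r))))
  where
  below-part : Below θ l (3 + r) ⇔ Below θ l (2 + r)
  below-part = mk⇔ (λ (a , b , e , h) → a , b , e , to (holds-cong θ q (below a b (3 + r)) (below a b (2 + r)) refl) h)
                   (λ (a , b , e , h) → a , b , e , from (holds-cong θ q (below a b (3 + r)) (below a b (2 + r)) refl) h)

cap : ℕ → ℕ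
cap (suc (suc _)) = 2
cap n             = n

CapInvariant : Formula 1 → Set
CapInvariant ψ = ∀ l r → ψ ⟨ l , r ⟩ ⇔ ψ ⟨ cap l , cap r ⟩

shrinkable⇒capInvariant : ∀ ψ → (∀ l r → ψ ⟨ 3 + l , r ⟩ ⇔ ψ ⟨ 2 + l , r ⟩) →
                          (∀ l r → ψ ⟨ l , 3 + r ⟩ ⇔ ψ ⟨ l , 2 + r ⟩) → CapInvariant ψ
shrinkable⇒capInvariant ψ shrinkˡ shrinkʳ l r = ⇔.trans (capˡ l) (capʳ r)
  where
  capˡ : ∀ l → ψ ⟨ l , r ⟩ ⇔ ψ ⟨ cap l , r ⟩
  capˡ (suc (suc (suc l))) = ⇔.trans (shrinkˡ l r) (capˡ (suc (suc l)))
  capˡ zero                = ⇔.refl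
  capˡ (suc zero)          = ⇔.refl
  capˡ (suc (suc zero))    = ⇔.refl
  capʳ : ∀ r → ψ ⟨ cap l , r ⟩ ⇔ ψ ⟨ cap l , cap r ⟩
  capʳ (suc (suc (suc r))) = ⇔.trans (shrinkʳ (cap l) r) (capʳ (suc (suc r)))
  capʳ zero                = ⇔.refl
  capʳ (suc zero)          = ⇔.refl
  capʳ (suc (suc zero))    = ⇔.refl

cap-invariant : ∀ ψ → qcount ψ ≤ 2 → CapInvariant ψ
cap-invariant (x ≺ y)  _ l r = qfree-point-cong (x ≺ y) refl {l} {r} {cap l} {cap r}
cap-invariant (x ≐ y)  _ l r = qfree-point-cong (x ≐ y) refl {l} {r} {cap l} {cap r}
cap-invariant (¬ᶠ ψ)   q l r = ¬-cong-⇔ (cap-invariant ψ q l r)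
cap-invariant (ψ ∧ᶠ ψ') q l r =
  cap-invariant ψ (m+n≤o⇒m≤o (qcount ψ) q) l r ×-⇔ cap-invariant ψ' (m+n≤o⇒n≤o (qcount ψ) q) l r
cap-invariant (ψ ∨ᶠ ψ') q l r =
  cap-invariant ψ (m+n≤o⇒m≤o (qcount ψ) q) l r ⊎-⇔ cap-invariant ψ' (m+n≤o⇒n≤o (qcount ψ) q) l r
cap-invariant (∃ᶠ θ) (s≤s q) = shrinkable⇒capInvariant (∃ᶠ θ) (∃-shrink-left θ q) (∃-shrink-right θ q)
cap-invariant (∀ᶠ θ) (s≤s q) l r =
  ∀ᶠ-cong θ (shrinkable⇒capInvariant (∃ᶠ (¬ᶠ θ)) (∃-shrink-left (¬ᶠ θ) q) (∃-shrink-right (¬ᶠ θ) q) l r)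

below-0 : ∀ {θ r} → ¬ Below θ 0 r
below-0 (zero  , _ , () , _)
below-0 (suc _ , _ , () , _)

below-1 : ∀ {θ r} → Below θ 1 r → θ ⟪ below 0 0 r ⟫
below-1 (zero , zero , refl , h) = h
below-1 (suc zero    , _ , () , _)
below-1 (suc (suc _) , _ , () , _)

below-2 : ∀ {θ r} → Below θ 2 r → θ ⟪ below 0 1 r ⟫ ⊎ θ ⟪ below 1 0 r ⟫
below-2 (zero     , suc zero , refl , h) = inj₁ h
below-2 (suc zero , zero     , refl , h) = inj₂ h
below-2 (suc (suc zero)    , _ , () , _)
below-2 (suc (suc (suc _)) , _ , () , _)

above-0 : ∀ {θ l} → ¬ Above θ l 0
above-0 (zero  , _ , () , _)
above-0 (suc _ , _ , () , _)

above-1 : ∀ {θ l} → Above θ l 1 → θ ⟪ above l 0 0 ⟫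
above-1 (zero , zero , refl , h) = h
above-1 (suc zero    , _ , () , _)
above-1 (suc (suc _) , _ , () , _)

above-2 : ∀ {θ l} → Above θ l 2 → θ ⟪ above l 0 1 ⟫ ⊎ θ ⟪ above l 1 0 ⟫
above-2 (zero     , suc zero , refl , h) = inj₁ h
above-2 (suc zero , zero     , refl , h) = inj₂ h
above-2 (suc (suc zero)    , _ , () , _)
above-2 (suc (suc (suc _)) , _ , () , _)

refuted-by-split : ∀ θ → qcount θ ≤ 1 → ∀ p p₁ p₂ → ShapeSplit (shape p) (shape p₁) (shape p₂) →
                   ¬ θ ⟪ p ⟫ → θ ⟪ p₂ ⟫ → ¬ θ ⟪ p₁ ⟫
refuted-by-split θ q p p₁ p₂ s ¬h h₂ h₁ with holds-split θ q p p₁ p₂ s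
... | inj₁ e = ¬h (from e h₁)
... | inj₂ e = ¬h (from e h₂)

both-hold : ∀ {A B : Set} → A → B → A ⇔ B
both-hold a b = mk⇔ (λ _ → b) (λ _ → a)

both-fail : ∀ {A B : Set} → ¬ A → ¬ B → A ⇔ B
both-fail ¬a ¬b = mk⇔ (⊥-elim ∘ ¬a) (⊥-elim ∘ ¬b)

-- The nodes of the 4-chain; capped c is the position of c with gaps capped
-- at 2, which is also that of the corresponding end node of a longer chain.
data Corner : Set where
  first second third fourth : Corner

capped : Corner → ℕ × ℕ
capped first  = 0 , 2
capped second = 1 , 2
capped third  = 2 , 1
capped fourth = 2 , 0

SomeCorner : Formula 1 → Set
SomeCorner ψ = Σ Corner λ c → ψ ⟨ capped c ⟩

MiddleReducible : Formula 1 → Set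
MiddleReducible ψ = Σ Corner λ c → ψ ⟨ 2 , 2 ⟩ ⇔ ψ ⟨ capped c ⟩

∃-refuted : ∀ θ {l r} → ¬ Below θ l r → ¬ θ ⟪ equal l r ⟫ → ¬ Above θ l r → ¬ (∃ᶠ θ) ⟨ l , r ⟩
∃-refuted θ nb ne na = [ nb , [ ne , na ]′ ]′ ∘ to (∃-partners θ _ _)

∃-middle-holds : ∀ θ → qcount θ ≤ 1 → (∃ᶠ θ) ⟨ 2 , 2 ⟩ → SomeCorner (∃ᶠ θ)
∃-middle-holds θ q m = witnessed (to (∃-partners θ 2 2) m)
  where
  move : ∀ p p' → shape p ≡ shape p' → θ ⟪ p ⟫ → θ ⟪ p' ⟫
  move = holds-move θ q
  witnessed : Below θ 2 2 ⊎ θ ⟪ equal 2 2 ⟫ ⊎ Above θ 2 2 → SomeCorner (∃ᶠ θ)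
  witnessed (inj₁ b) = third , [ below-at θ ∘ move (below 0 1 2) (below 0 1 1) refl
                               , below-at θ ∘ move (below 1 0 2) (below 1 0 1) refl ]′ (below-2 b)
  witnessed (inj₂ (inj₁ h)) = second , equal-at θ (move (equal 2 2) (equal 1 2) refl h)
  witnessed (inj₂ (inj₂ a)) = second , [ above-at θ ∘ move (above 2 0 1) (above 1 0 1) refl
                                       , above-at θ ∘ move (above 2 1 0) (above 1 1 0) refl ]′ (above-2 a)

-- The second node fails unless θ holds at below 0 0 2, and the third unless θ
-- holds at above 2 0 0; if both hold, splitting equal 2 2 into equal 0 2 and
-- equal 2 0 shows that the first or the fourth node fails.
∃-middle-fails : ∀ θ → qcount θ ≤ 1 → ¬ (∃ᶠ θ) ⟨ 2 , 2 ⟩ → SomeCorner (¬ᶠ (∃ᶠ θ))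
∃-middle-fails θ q ¬m = refuted
  where
  move : ∀ p p' → shape p ≡ shape p' → θ ⟪ p ⟫ → θ ⟪ p' ⟫
  move = holds-move θ q
  split : ∀ p p₁ p₂ → ShapeSplit (shape p) (shape p₁) (shape p₂) → ¬ θ ⟪ p ⟫ → θ ⟪ p₂ ⟫ → ¬ θ ⟪ p₁ ⟫
  split = refuted-by-split θ q
  decide : ∀ p → Dec (θ ⟪ p ⟫)
  decide p = holds? (size p) (assignment p) θ
  ¬b011 : ¬ θ ⟪ below 0 1 2 ⟫
  ¬b011 = ¬m ∘ below-at θ
  ¬b101 : ¬ θ ⟪ below 1 0 2 ⟫
  ¬b101 = ¬m ∘ below-at θ
  ¬e11 : ¬ θ ⟪ equal 2 2 ⟫
  ¬e11 = ¬m ∘ equal-at θ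
  ¬a101 : ¬ θ ⟪ above 2 0 1 ⟫
  ¬a101 = ¬m ∘ above-at θ
  ¬a110 : ¬ θ ⟪ above 2 1 0 ⟫
  ¬a110 = ¬m ∘ above-at θ
  refuted : SomeCorner (¬ᶠ (∃ᶠ θ))
  refuted with decide (below 0 0 2)
  ... | no ¬b001 = second , ∃-refuted θ (¬b001 ∘ below-1) (¬e11 ∘ move (equal 1 2) (equal 2 2) refl)
                             ([ ¬a101 ∘ move (above 1 0 1) (above 2 0 1) refl
                              , ¬a110 ∘ move (above 1 1 0) (above 2 1 0) refl ]′ ∘ above-2)
  ... | yes b001 with decide (above 2 0 0)
  ...   | no ¬a100 = third , ∃-refuted θ ([ ¬b011 ∘ move (below 0 1 1) (below 0 1 2) refl
                                          , ¬b101 ∘ move (below 1 0 1) (below 1 0 2) refl ]′ ∘ below-2)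
                                         (¬e11 ∘ move (equal 2 1) (equal 2 2) refl) (¬a100 ∘ above-1)
  ...   | yes a100 with holds-split θ q (equal 2 2) (equal 0 2) (equal 2 0) (right , left)
  ...     | inj₁ e = first , ∃-refuted θ below-0 (¬e11 ∘ from e)
                               ([ split (above 2 0 1) (above 0 0 1) (above 2 0 0) (right , both , left) ¬a101 a100
                                , split (above 2 1 0) (above 0 1 0) (above 2 0 0) (right , left , both) ¬a110 a100 ]′ ∘ above-2)
  ...     | inj₂ e = fourth , ∃-refuted θ ([ split (below 0 1 2) (below 0 1 0) (below 0 0 2) (both , left , right) ¬b011 b001
                                           , split (below 1 0 2) (below 1 0 0) (below 0 0 2) (left , both , right) ¬b101 b001 ]′ ∘ below-2)
                                          (¬e11 ∘ from e) above-0

∃-middle : ∀ θ → qcount θ ≤ 1 → MiddleReducible (∃ᶠ θ)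
∃-middle θ q with holds? 5 (point 2) (∃ᶠ θ)
... | yes m = map₂ (both-hold m) (∃-middle-holds θ q m)
... | no ¬m = map₂ (both-fail ¬m) (∃-middle-fails θ q ¬m)

middle-reducible : ∀ ψ → qcount ψ ≤ 2 → MiddleReducible ψ
middle-reducible (x ≺ y) _ = second , qfree-point-cong (x ≺ y) refl {2} {2} {1} {2}
middle-reducible (x ≐ y) _ = second , qfree-point-cong (x ≐ y) refl {2} {2} {1} {2}
middle-reducible (¬ᶠ ψ)  q = map₂ ¬-cong-⇔ (middle-reducible ψ q)
middle-reducible (ψ ∧ᶠ ψ') q with +≤2-cases (qcount ψ) q
... | inj₁ (z , q') = map₂ (qfree-point-cong ψ z ×-⇔_) (middle-reducible ψ' q')
... | inj₂ (inj₁ (z , q')) = map₂ (_×-⇔ qfree-point-cong ψ' z) (middle-reducible ψ q')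
... | inj₂ (inj₂ (q₁ , q₂)) = second , (count≤1-point-cong ψ q₁ refl refl ×-⇔ count≤1-point-cong ψ' q₂ refl refl)
middle-reducible (ψ ∨ᶠ ψ') q with +≤2-cases (qcount ψ) q
... | inj₁ (z , q') = map₂ (qfree-point-cong ψ z ⊎-⇔_) (middle-reducible ψ' q')
... | inj₂ (inj₁ (z , q')) = map₂ (_⊎-⇔ qfree-point-cong ψ' z) (middle-reducible ψ q')
... | inj₂ (inj₂ (q₁ , q₂)) = second , (count≤1-point-cong ψ q₁ refl refl ⊎-⇔ count≤1-point-cong ψ' q₂ refl refl)
middle-reducible (∃ᶠ θ) (s≤s q) = ∃-middle θ q
middle-reducible (∀ᶠ θ) (s≤s q) = map₂ (∀ᶠ-cong θ) (∃-middle (¬ᶠ θ) q)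

SomePosition : ℕ → Formula 1 → Set
SomePosition N ψ = Σ (ℕ × ℕ) λ (l , r) → l + suc r ≡ N × ψ ⟨ l , r ⟩

∃-positions : ∀ N ψ → Holds N noVars (∃ᶠ ψ) ⇔ SomePosition N ψ
∃-positions N ψ = mk⇔
  (λ (y , y<N , h) → let r , e = <⇒+suc y<N in (y , r) , e , subst (λ M → Holds M (point y) ψ) (sym e) h)
  (λ ((l , r) , e , h) → l , subst (l <_) e (<+suc l r) , subst (λ M → Holds M (point l) ψ) e h)

positions-4 : ∀ ψ → CapInvariant ψ → SomePosition 4 ψ ⇔ SomeCorner ψ
positions-4 ψ capInv = mk⇔ corner position
  where
  corner : SomePosition 4 ψ → SomeCorner ψ
  corner ((0 , _) , refl , h) = first  , to (capInv 0 3) h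
  corner ((1 , _) , refl , h) = second , to (capInv 1 2) h
  corner ((2 , _) , refl , h) = third  , to (capInv 2 1) h
  corner ((3 , _) , refl , h) = fourth , to (capInv 3 0) h
  corner ((suc (suc (suc (suc zero))) , _) , () , _)
  corner ((suc (suc (suc (suc (suc _)))) , _) , () , _)
  position : SomeCorner ψ → SomePosition 4 ψ
  position (first  , h) = (0 , 3) , refl , from (capInv 0 3) h
  position (second , h) = (1 , 2) , refl , from (capInv 1 2) h
  position (third  , h) = (2 , 1) , refl , from (capInv 2 1) h
  position (fourth , h) = (3 , 0) , refl , from (capInv 3 0) h

positions-long : ∀ ψ k → CapInvariant ψ →
  SomePosition (5 + k) ψ ⇔ (SomeCorner ψ ⊎ ψ ⟨ 2 , 2 ⟩)
positions-long ψ k capInv = mk⇔ classify position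
  where
  classify : SomePosition (5 + k) ψ → SomeCorner ψ ⊎ ψ ⟨ 2 , 2 ⟩
  classify ((0 , suc (suc r)) , _ , h) = inj₁ (first , to (capInv 0 (2 + r)) h)
  classify ((1 , suc (suc r)) , _ , h) = inj₁ (second , to (capInv 1 (2 + r)) h)
  classify ((suc (suc l) , 1) , _ , h) = inj₁ (third , to (capInv (2 + l) 1) h)
  classify ((suc (suc l) , 0) , _ , h) = inj₁ (fourth , to (capInv (2 + l) 0) h)
  classify ((suc (suc l) , suc (suc r)) , _ , h) = inj₂ (to (capInv (2 + l) (2 + r)) h)
  classify ((0 , 0) , () , _)
  classify ((0 , 1) , () , _)
  classify ((1 , 0) , () , _)
  classify ((1 , 1) , () , _)
  position : SomeCorner ψ ⊎ ψ ⟨ 2 , 2 ⟩ → SomePosition (5 + k) ψ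
  position (inj₁ (first  , h)) = (0 , 4 + k) , refl , from (capInv 0 (4 + k)) h
  position (inj₁ (second , h)) = (1 , 3 + k) , refl , from (capInv 1 (3 + k)) h
  position (inj₁ (third  , h)) = (3 + k , 1) , cong (3 +_) (+-comm k 2) , from (capInv (3 + k) 1) h
  position (inj₁ (fourth , h)) = (4 + k , 0) , cong (4 +_) (+-comm k 1) , from (capInv (4 + k) 0) h
  position (inj₂ h) = (2 , 2 + k) , refl , from (capInv 2 (2 + k)) h

∃-chain-cong : ∀ ψ k → CapInvariant ψ → MiddleReducible ψ → Holds 4 noVars (∃ᶠ ψ) ⇔ Holds (5 + k) noVars (∃ᶠ ψ)
∃-chain-cong ψ k capInv (c , e) =
  ⇔.trans (∃-positions 4 ψ) (⇔.trans (positions-4 ψ capInv)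
    (⇔.trans absorb (⇔.sym (⇔.trans (∃-positions (5 + k) ψ) (positions-long ψ k capInv)))))
  where
  absorb : SomeCorner ψ ⇔ (SomeCorner ψ ⊎ ψ ⟨ 2 , 2 ⟩)
  absorb = mk⇔ inj₁ [ id , (λ h → c , to e h) ]′

sentence-cong : ∀ k (φ : Sentence) → qcount φ ≤ 3 → Holds 4 noVars φ ⇔ Holds (5 + k) noVars φ
sentence-cong k (() ≺ _) _
sentence-cong k (() ≐ _) _
sentence-cong k (¬ᶠ φ)   q = ¬-cong-⇔ (sentence-cong k φ q)
sentence-cong k (φ ∧ᶠ ψ) q =
  sentence-cong k φ (m+n≤o⇒m≤o (qcount φ) q) ×-⇔ sentence-cong k ψ (m+n≤o⇒n≤o (qcount φ) q)
sentence-cong k (φ ∨ᶠ ψ) q =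
  sentence-cong k φ (m+n≤o⇒m≤o (qcount φ) q) ⊎-⇔ sentence-cong k ψ (m+n≤o⇒n≤o (qcount φ) q)
sentence-cong k (∃ᶠ ψ) (s≤s q) = ∃-chain-cong ψ k (cap-invariant ψ q) (middle-reducible ψ q)
sentence-cong k (∀ᶠ ψ) (s≤s q) =
  ∀ᶠ-cong ψ (∃-chain-cong (¬ᶠ ψ) k (cap-invariant (¬ᶠ ψ) q) (middle-reducible (¬ᶠ ψ) q))

path : ℕ → Tree
path zero    = node []
path (suc n) = node (path n ∷ [])

depth-path : ∀ n → depth (path n) ≡ suc n
depth-path zero    = refl
depth-path (suc n) = cong suc (trans (⊔-identityʳ (depth (path n))) (depth-path n))

level : ∀ {t} → Node t → ℕ
level u = length (proj₁ u)

path-node : ∀ n p → ValidPath (path n) p → p ≡ replicate (length p) 0 × length p ≤ n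
path-node n       []          _ = refl , z≤n
path-node (suc n) (zero ∷ p)  v = let e , l = path-node n p v in cong (0 ∷_) e , s≤s l

validPath-irrelevant : ∀ n p (v w : ValidPath (path n) p) → v ≡ w
validPath-irrelevant n       []         v w = refl
validPath-irrelevant (suc n) (zero ∷ p) v w = validPath-irrelevant n p v w

replicate-valid : ∀ n i → i ≤ n → ValidPath (path n) (replicate i 0)
replicate-valid n       zero    _       = tt
replicate-valid (suc n) (suc i) (s≤s l) = replicate-valid n i l

⊏⇒length< : ∀ {p q} → p ⊏ q → length p < length q
⊏⇒length< []⊏    = s≤s z≤n
⊏⇒length< (∷⊏ h) = s≤s (⊏⇒length< h)

replicate-⊏ : ∀ {a b} → a < b → replicate a 0 ⊏ replicate b 0
replicate-⊏ {zero}  {suc b} _       = []⊏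
replicate-⊏ {suc a} {suc b} (s≤s l) = ∷⊏ (replicate-⊏ l)

level< : ∀ n (u : Node (path n)) → level u < suc n
level< n (p , v) = s≤s (proj₂ (path-node n p v))

level-⊏ : ∀ n (u w : Node (path n)) → level u < level w → proj₁ u ⊏ proj₁ w
level-⊏ n (p , v) (p' , v') l = subst₂ _⊏_ (sym (proj₁ (path-node n p v))) (sym (proj₁ (path-node n p' v'))) (replicate-⊏ l)

level-injective : ∀ n (u w : Node (path n)) → level u ≡ level w → u ≡ w
level-injective n (p , v) (p' , v') e with path-node n p v | path-node n p' v'
... | p≡ , _ | p'≡ , _ = node-≡ (trans p≡ (trans (cong (λ i → replicate i 0) e) (sym p'≡))) v v'
  where
  node-≡ : ∀ {p p'} → p ≡ p' → (v : ValidPath (path n) p) (v' : ValidPath (path n) p') → _≡_ {A = Node (path n)} (p , v) (p' , v')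
  node-≡ {p} refl v v' = cong (p ,_) (validPath-irrelevant n p v v')

nodeAt : ∀ n i → i < suc n → Node (path n)
nodeAt n i l = replicate i 0 , replicate-valid n i (≤-pred l)

extend-levels : ∀ {t m} {ρ : Fin m → Node t} {σ : Fin m → ℕ} → (∀ v → σ v ≡ level (ρ v)) →
                ∀ {i} u → i ≡ level u → ∀ v → extend i σ v ≡ level (extend u ρ v)
extend-levels e u i≡ zero    = i≡
extend-levels e u i≡ (suc v) = e v

path-holds : ∀ n {m} (φ : Formula m) (ρ : Fin m → Node (path n)) (σ : Fin m → ℕ) →
             (∀ v → σ v ≡ level (ρ v)) → Sat (path n) ρ φ ⇔ Holds (suc n) σ φ
path-holds n (x ≺ y) ρ σ e =
  mk⇔ (λ h → subst₂ _<_ (sym (e y)) (sym (e x)) (⊏⇒length< h))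
      (λ h → level-⊏ n (ρ y) (ρ x) (subst₂ _<_ (e y) (e x) h))
path-holds n (x ≐ y) ρ σ e =
  mk⇔ (λ h → trans (e x) (trans (cong level h) (sym (e y))))
      (λ h → level-injective n (ρ x) (ρ y) (trans (sym (e x)) (trans h (e y))))
path-holds n (¬ᶠ φ)   ρ σ e = ¬-cong-⇔ (path-holds n φ ρ σ e)
path-holds n (φ ∧ᶠ ψ) ρ σ e = path-holds n φ ρ σ e ×-⇔ path-holds n ψ ρ σ e
path-holds n (φ ∨ᶠ ψ) ρ σ e = path-holds n φ ρ σ e ⊎-⇔ path-holds n ψ ρ σ e
path-holds n (∃ᶠ φ)   ρ σ e =
  mk⇔ (λ (u , h) → level u , level< n u , to (at-node u refl) h)
      (λ (i , l , h) → nodeAt n i l , from (at-node (nodeAt n i l) (sym (length-replicate i))) h)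
  where
  at-node : ∀ u {i} → i ≡ level u → Sat (path n) (extend u ρ) φ ⇔ Holds (suc n) (extend i σ) φ
  at-node u i≡ = path-holds n φ (extend u ρ) (extend _ σ) (extend-levels e u i≡)
path-holds n (∀ᶠ φ)   ρ σ e =
  mk⇔ (λ h i l → to (at-node (nodeAt n i l) (sym (length-replicate i))) (h (nodeAt n i l)))
      (λ h u → from (at-node u refl) (h (level u) (level< n u)))
  where
  at-node : ∀ u {i} → i ≡ level u → Sat (path n) (extend u ρ) φ ⇔ Holds (suc n) (extend i σ) φ
  at-node u i≡ = path-holds n φ (extend u ρ) (extend _ σ) (extend-levels e u i≡)

path-⊨ : ∀ n φ → path n ⊨ φ ⇔ Holds (suc n) noVars φ
path-⊨ n φ = path-holds n φ noVars noVars (λ ())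

upper-bound : ∀ z → DefinesDepth 3 z → z ≤ 4
upper-bound (suc (suc (suc (suc (suc k))))) (φ , qφ , deep , shallow) =
  ⊥-elim (shallow (path 3) (s≤s (s≤s (s≤s (s≤s (s≤s z≤n)))))
    (from (path-⊨ 3 φ) (from (sentence-cong k φ (≤-reflexive qφ))
      (to (path-⊨ (4 + k) φ) (deep (path (4 + k)) (≤-reflexive (sym (depth-path (4 + k)))))))))
upper-bound zero                      _ = z≤n
upper-bound (suc zero)                _ = s≤s z≤n
upper-bound (suc (suc zero))          _ = s≤s (s≤s z≤n)
upper-bound (suc (suc (suc zero)))    _ = s≤s (s≤s (s≤s z≤n))
upper-bound (suc (suc (suc (suc zero)))) _ = s≤s (s≤s (s≤s (s≤s z≤n)))

mutual
  deep-node : ∀ t n → suc n ≤ depth t → Σ (List ℕ) λ p → ValidPath t p × length p ≡ n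
  deep-node t         zero    _       = [] , tt , refl
  deep-node (node ts) (suc n) (s≤s h) = let i , p , v , e = deep-child ts n h in i ∷ p , v , cong suc e

  deep-child : ∀ ts n → suc n ≤ depthList ts → Σ ℕ λ i → Σ (List ℕ) λ p → ValidChild ts i p × length p ≡ n
  deep-child (t ∷ ts) n h with ⊔-sel (depth t) (depthList ts)
  ... | inj₁ e = let p , v , e' = deep-node t n (subst (suc n ≤_) e h) in 0 , p , v , e'
  ... | inj₂ e = let i , p , v , e' = deep-child ts n (subst (suc n ≤_) e h) in suc i , p , v , e'

mutual
  length<depth : ∀ t p → ValidPath t p → length p < depth t
  length<depth (node ts) []      _ = s≤s z≤n
  length<depth (node ts) (i ∷ p) v = s≤s (length<depthList ts i p v)

  length<depthList : ∀ ts i p → ValidChild ts i p → length p < depthList ts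
  length<depthList (t ∷ ts) zero    p v = ≤-trans (length<depth t p v) (m≤m⊔n (depth t) (depthList ts))
  length<depthList (t ∷ ts) (suc i) p v = ≤-trans (length<depthList ts i p v) (m≤n⊔m (depth t) (depthList ts))

mutual
  prefix-valid : ∀ t p q → ValidPath t (p ++ q) → ValidPath t p
  prefix-valid t         []      q v = tt
  prefix-valid (node ts) (i ∷ p) q v = prefix-validChild ts i p q v

  prefix-validChild : ∀ ts i p q → ValidChild ts i (p ++ q) → ValidChild ts i p
  prefix-validChild (t ∷ ts) zero    p q v = prefix-valid t p q v
  prefix-validChild (t ∷ ts) (suc i) p q v = prefix-validChild ts i p q v

⊏-head : ∀ {x y p q} → (x ∷ p) ⊏ (y ∷ q) → x ≡ y × p ⊏ q
⊏-head (∷⊏ h) = refl , h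

chain⇒deep : ∀ t {p₀ p₁ p₂ p₃} → p₀ ⊏ p₁ → p₁ ⊏ p₂ → p₂ ⊏ p₃ → ValidPath t p₃ → 4 ≤ depth t
chain⇒deep t {p₁ = p₁} {p₂} {p₃} h₀ h₁ h₂ v = ≤-trans (s≤s l₃) (length<depth t p₃ v)
  where
  l₁ : 1 ≤ length p₁
  l₁ = ≤-trans (s≤s z≤n) (⊏⇒length< h₀)
  l₂ : 2 ≤ length p₂
  l₂ = ≤-trans (s≤s l₁) (⊏⇒length< h₁)
  l₃ : 3 ≤ length p₃
  l₃ = ≤-trans (s≤s l₂) (⊏⇒length< h₂)

-- (y = x → z ≺ x) ∧ (y ≺ x → x ≺ z) ∧ (x ≺ y → y ≺ z ∨ (x ≺ z ∧ z ≺ y)): under ∃x ∀y ∃z,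
-- x has a proper descendant and a proper ancestor, and every proper ancestor of x
-- has a proper ancestor or a node strictly between it and x.
deep-matrix : Formula 3
deep-matrix = ((¬ᶠ (y ≐ x)) ∨ᶠ (z ≺ x)) ∧ᶠ
              (((¬ᶠ (y ≺ x)) ∨ᶠ (x ≺ z)) ∧ᶠ
               ((¬ᶠ (x ≺ y)) ∨ᶠ ((y ≺ z) ∨ᶠ ((x ≺ z) ∧ᶠ (z ≺ y)))))
  where
  x y z : Fin 3
  x = suc (suc zero)
  y = suc zero
  z = zero

depth≥4 : Sentence
depth≥4 = ∃ᶠ (∀ᶠ (∃ᶠ deep-matrix))

depth≥4-holds : ∀ t → 4 ≤ depth t → t ⊨ depth≥4
depth≥4-holds t h with deep-node t 3 h
... | a ∷ b ∷ c ∷ [] , v , refl = x , partner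
  where
  x : Node t
  x = (a ∷ b ∷ []) , prefix-valid t (a ∷ b ∷ []) (c ∷ []) v
  root : Node t
  root = [] , tt
  Partner : Node t → Node t → Set
  Partner y z = Sat t (extend z (extend y (extend x noVars))) deep-matrix
  unrelated : ∀ a' b' p (w : ValidPath t (a' ∷ b' ∷ p)) → ¬ (a' ≡ a × b' ≡ b) → Partner ((a' ∷ b' ∷ p) , w) root
  unrelated a' b' p w ne =
    inj₁ (λ y≡x → ne (∷-injectiveˡ (cong proj₁ y≡x) , ∷-injectiveˡ (∷-injectiveʳ (cong proj₁ y≡x)))) ,
    inj₁ (λ x⊏y → ne (sym (proj₁ (⊏-head x⊏y)) , sym (proj₁ (⊏-head (proj₂ (⊏-head x⊏y)))))) ,
    inj₁ (λ y⊏x → case-⊏[] (proj₂ (⊏-head (proj₂ (⊏-head y⊏x)))))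
    where
    case-⊏[] : ∀ {p} → ¬ (p ⊏ [])
    case-⊏[] ()
  partner : (y : Node t) → Σ (Node t) (Partner y)
  partner ([] , _) = ((a ∷ []) , prefix-valid t (a ∷ []) (b ∷ c ∷ []) v) ,
    inj₁ (λ ()) , inj₁ (λ ()) , inj₂ (inj₂ (∷⊏ []⊏ , []⊏))
  partner ((a' ∷ []) , _) with a' ≟ a
  ... | yes refl = root , inj₁ (λ ()) , inj₁ (λ { (∷⊏ ()) }) , inj₂ (inj₁ []⊏)
  ... | no a'≢a = root , inj₁ (λ ()) , inj₁ (λ { (∷⊏ ()) }) , inj₁ (λ y⊏x → a'≢a (proj₁ (⊏-head y⊏x)))
  partner ((a' ∷ b' ∷ p) , w) with a' ≟ a | b' ≟ b
  partner ((a' ∷ b' ∷ []) , w) | yes refl | yes refl =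
    ((a ∷ b ∷ c ∷ []) , v) , inj₂ (∷⊏ (∷⊏ []⊏)) , inj₁ (λ { (∷⊏ (∷⊏ ())) }) , inj₁ (λ { (∷⊏ (∷⊏ ())) })
  partner ((a' ∷ b' ∷ d ∷ p) , w) | yes refl | yes refl =
    root , inj₁ (λ ()) , inj₂ []⊏ , inj₁ (λ { (∷⊏ (∷⊏ ())) })
  partner ((a' ∷ b' ∷ p) , w) | yes _ | no b'≢b = root , unrelated a' b' p w (b'≢b ∘ proj₂)
  partner ((a' ∷ b' ∷ p) , w) | no a'≢a | _ = root , unrelated a' b' p w (a'≢a ∘ proj₁)
... | [] , _ , ()
... | _ ∷ [] , _ , ()
... | _ ∷ _ ∷ [] , _ , ()
... | _ ∷ _ ∷ _ ∷ _ ∷ _ , _ , ()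

depth≥4-fails : ∀ t → depth t < 4 → ¬ (t ⊨ depth≥4)
depth≥4-fails t d (x , h) with h x
... | z₁ , inj₁ x≢x , _ = x≢x refl
... | z₁ , inj₂ x⊏z₁ , _ with h z₁
...   | z₂ , _ , inj₁ ¬x⊏z₁ , _ = ¬x⊏z₁ x⊏z₁
...   | z₂ , _ , inj₂ z₂⊏x , _ with h z₂
...     | z₃ , _ , _ , inj₁ ¬z₂⊏x = ¬z₂⊏x z₂⊏x
...     | z₃ , _ , _ , inj₂ (inj₁ z₃⊏z₂) = <⇒≱ d (chain⇒deep t z₃⊏z₂ z₂⊏x x⊏z₁ (proj₂ z₁))
...     | z₃ , _ , _ , inj₂ (inj₂ (z₃⊏x , z₂⊏z₃)) = <⇒≱ d (chain⇒deep t z₂⊏z₃ z₃⊏x x⊏z₁ (proj₂ z₁))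

lemma3p9 : IsT 3 4
lemma3p9 = (depth≥4 , refl , depth≥4-holds , depth≥4-fails) , upper-bound
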